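{- Let $t \ge 3$ be an integer and let $G$ be a finite simple connected graph with minimum degree $\delta(G) = 1$. Then $M_t(G)$ is not a distance magic graph.
   Context: For a graph $G=(V,E)$ and an integer $t \ge 1$, the generalised Mycielskian $M_t(G)$ is the graph with vertex set $(V \times \{0,1,\dots,t-1\}) \cup \{u\}$ (where $u$ is a new vertex), whose edges are: $(x,0)(y,0)$ for every edge $xy \in E$; $(x,i)(y,i+1)$ for every $0 \le i \le t-2$ and every ordered pair $(x,y)$ with $xy \in E$; and $(x,t-1)u$ for every $x \in V$. A graph $H$ on $N$ vertices is distance magic if there is a bijection $f: V(H) \to \{1,2,\dots,N\}$ and a constant $k$ such that for every vertex $v$, $\sum_{w \in N(v)} f(w) = k$, where $N(v)$ is the open neighbourhood of $v$. -}

module Defs where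

open import Data.Nat using (ℕ; zero; suc; _+_; _*_; _≤_; _≡ᵇ_)
import Data.Fin
open import Data.Fin using (Fin; toℕ)
open import Data.Bool using (Bool; true; false; if_then_else_; _∧_; _∨_)
open import Data.Product using (Σ; ∃; _×_; _,_)
open import Relation.Binary.PropositionalEquality using (_≡_)
open import Function.Bundles using (_⤖_; Bijection)

Σ[<] : (n : ℕ) → (Fin n → ℕ) → ℕ
Σ[<] zero    f = 0
Σ[<] (suc n) f = f Data.Fin.zero + Σ[<] n (λ i → f (Data.Fin.suc i))

record Graph : Set where
  field
    n     : ℕ
    adj   : Fin n → Fin n → Bool
    sym   : ∀ x y → adj x y ≡ adj y x
    irrefl : ∀ x → adj x x ≡ false
open Graph public

deg : (G : Graph) → Fin (n G) → ℕ
deg G x = Σ[<] (n G) (λ y → if adj G x y then 1 else 0)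

data Reach (G : Graph) (x : Fin (n G)) : Fin (n G) → Set where
  here : Reach G x x
  step : ∀ {y z} → Reach G x y → adj G y z ≡ true → Reach G x z

Connected : Graph → Set
Connected G = ∀ x y → Reach G x y

MinDegreeOne : Graph → Set
MinDegreeOne G = (∀ x → 1 ≤ deg G x) × ∃ λ x → deg G x ≡ 1

-- Vertices of the generalised Mycielskian M_t(G): (x,i) for x ∈ V, i < t, and u
data MVert (G : Graph) (t : ℕ) : Set where
  base : Fin (n G) → Fin t → MVert G t
  apex : MVert G t

madj : (G : Graph) (t : ℕ) → MVert G t → MVert G t → Bool
madj G t (base x i) (base y j) =
  adj G x y ∧ (((toℕ i ≡ᵇ 0) ∧ (toℕ j ≡ᵇ 0))
               ∨ (toℕ j ≡ᵇ suc (toℕ i)) ∨ (toℕ i ≡ᵇ suc (toℕ j)))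
madj G t (base x i) apex = suc (toℕ i) ≡ᵇ t
madj G t apex (base y j) = suc (toℕ j) ≡ᵇ t
madj G t apex apex = false

mSize : Graph → ℕ → ℕ
mSize G t = n G * t + 1

mSum : (G : Graph) (t : ℕ) → (MVert G t → ℕ) → ℕ
mSum G t g = Σ[<] (n G) (λ x → Σ[<] t (λ i → g (base x i))) + g apex

-- M_t(G) is distance magic: a bijection f : V → {1..N} (encoded as Fin N,
-- label of v being toℕ (f v) + 1) with constant open-neighbourhood sums
MycielskianDistanceMagic : Graph → ℕ → Set
MycielskianDistanceMagic G t =
  Σ (MVert G t ⤖ Fin (mSize G t)) λ f →
    ∃ λ k → ∀ v →
      mSum G t (λ w → if madj G t v w
                        then suc (toℕ (Bijection.to f w)) else 0) ≡ k

{-# OPTIONS --safe #-}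
-- If x is a leaf of G with neighbour y, then in M_t(G) the vertex (x,0) has
-- neighbourhood {(y,0),(y,1)} and, as t ≥ 3, the vertex (x,1) has neighbourhood
-- {(y,0),(y,2)}. Equal neighbourhood sums force f(y,1) = f(y,2), contradicting
-- injectivity of the labelling.
module Submission where

open import Defs hiding (sym)
open import Data.Nat using (ℕ; _≤_; zero; suc; _+_; s≤s; z≤n)
open import Data.Nat.Properties using (+-identityʳ; +-cancelˡ-≡; suc-injective)
open import Data.Fin using (Fin; toℕ; #_)
import Data.Fin as Fin
open import Data.Fin.Properties using (toℕ-injective) renaming (suc-injective to Fin-suc-injective)
open import Data.Bool using (Bool; true; false; if_then_else_)
open import Data.Product using (∃; _×_; _,_; proj₁; proj₂)
open import Function using (_∘_)
open import Function.Bundles using (Bijection)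
open import Relation.Nullary using (¬_)
open import Relation.Binary.PropositionalEquality
  using (_≡_; _≢_; refl; sym; cong; cong₂; trans; module ≡-Reasoning)

Σ[<]-zero : ∀ n {f : Fin n → ℕ} → (∀ i → f i ≡ 0) → Σ[<] n f ≡ 0
Σ[<]-zero zero    vanish = refl
Σ[<]-zero (suc n) vanish =
  cong₂ _+_ (vanish Fin.zero) (Σ[<]-zero n (vanish ∘ Fin.suc))

Σ[<]-single : ∀ {n} {f : Fin n → ℕ} (y : Fin n) →
              (∀ z → z ≢ y → f z ≡ 0) → Σ[<] n f ≡ f y
Σ[<]-single {suc n} {f} Fin.zero vanish = trans
  (cong (f Fin.zero +_) (Σ[<]-zero n (λ z → vanish (Fin.suc z) λ ())))
  (+-identityʳ (f Fin.zero))
Σ[<]-single {suc n} (Fin.suc y) vanish = cong₂ _+_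
  (vanish Fin.zero λ ())
  (Σ[<]-single y (λ z z≢y → vanish (Fin.suc z) (z≢y ∘ Fin-suc-injective)))

count : ∀ n → (Fin n → Bool) → ℕ
count n b = Σ[<] n (λ i → if b i then 1 else 0)

count≡0⇒false : ∀ n (b : Fin n → Bool) → count n b ≡ 0 → ∀ z → b z ≡ false
count≡0⇒false (suc n) b c≡0 z with b Fin.zero in b₀
count≡0⇒false (suc n) b c≡0 Fin.zero    | false = b₀
count≡0⇒false (suc n) b c≡0 (Fin.suc z) | false =
  count≡0⇒false n (b ∘ Fin.suc) c≡0 z

Unique : ∀ {n} → (Fin n → Bool) → Fin n → Set
Unique b y = b y ≡ true × (∀ z → b z ≡ true → z ≡ y)

count≡1⇒unique : ∀ n (b : Fin n → Bool) → count n b ≡ 1 → ∃ (Unique b)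
count≡1⇒unique (suc n) b c≡1 with b Fin.zero in b₀
... | true = Fin.zero , b₀ , only-zero
  where
  rest-false : ∀ z → b (Fin.suc z) ≡ false
  rest-false = count≡0⇒false n (b ∘ Fin.suc) (suc-injective c≡1)

  only-zero : ∀ z → b z ≡ true → z ≡ Fin.zero
  only-zero Fin.zero    _  = refl
  only-zero (Fin.suc z) bz with trans (sym bz) (rest-false z)
  ... | ()
... | false with count≡1⇒unique n (b ∘ Fin.suc) c≡1
... | y , by , only-y = Fin.suc y , by , only-suc-y
  where
  only-suc-y : ∀ z → b z ≡ true → z ≡ Fin.suc y
  only-suc-y Fin.zero bz with trans (sym bz) b₀
  ... | ()
  only-suc-y (Fin.suc z) bz = cong Fin.suc (only-y z bz)

degree-one⇒unique-neighbour : (G : Graph) (x : Fin (n G)) →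
                              deg G x ≡ 1 → ∃ (Unique (adj G x))
degree-one⇒unique-neighbour G x = count≡1⇒unique (n G) (adj G x)

neighbourhoodSum : (G : Graph) (t : ℕ) → (MVert G t → ℕ) → MVert G t → ℕ
neighbourhoodSum G t ℓ v = mSum G t (λ w → if madj G t v w then ℓ w else 0)

module Leaf (G : Graph) (t : ℕ) (ℓ : MVert G t → ℕ)
            {x y : Fin (n G)} (leaf : Unique (adj G x) y) where

  term : Fin t → MVert G t → ℕ
  term i w = if madj G t (base x i) w then ℓ w else 0

  row : Fin t → Fin (n G) → ℕ
  row i z = Σ[<] t (λ j → term i (base z j))

  row-nonneighbour : ∀ i z → z ≢ y → row i z ≡ 0
  row-nonneighbour i z z≢y with adj G x z in xz
  ... | false = Σ[<]-zero t (λ _ → refl)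
  ... | true with z≢y (proj₂ leaf z xz)
  ... | ()

  neighbourhoodSum-leaf : ∀ i →
    neighbourhoodSum G t ℓ (base x i) ≡ row i y + term i apex
  neighbourhoodSum-leaf i =
    cong (_+ term i apex) (Σ[<]-single y (row-nonneighbour i))

module _ (G : Graph) (t : ℕ) (ℓ : MVert G (3 + t) → ℕ)
         {x y : Fin (n G)} (leaf : Unique (adj G x) y) where

  open Leaf G (3 + t) ℓ leaf

  neighbour-row-0 : row (# 0) y ≡ ℓ (base y (# 0)) + ℓ (base y (# 1))
  neighbour-row-0 rewrite proj₁ leaf | Σ[<]-zero t {λ _ → 0} (λ _ → refl)
                      | +-identityʳ (ℓ (base y (# 1))) = refl

  neighbour-row-1 : row (# 1) y ≡ ℓ (base y (# 0)) + ℓ (base y (# 2))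
  neighbour-row-1 rewrite proj₁ leaf | Σ[<]-zero t {λ _ → 0} (λ _ → refl)
                      | +-identityʳ (ℓ (base y (# 2))) = refl

  -- The apex term vanishes definitionally: the apex only sees level 2 + t.
  equal-neighbourhoodSums⇒equal-labels :
    neighbourhoodSum G (3 + t) ℓ (base x (# 0)) ≡ neighbourhoodSum G (3 + t) ℓ (base x (# 1)) →
    ℓ (base y (# 1)) ≡ ℓ (base y (# 2))
  equal-neighbourhoodSums⇒equal-labels sums≡ = +-cancelˡ-≡ (ℓ (base y (# 0))) _ _ (begin
    ℓ (base y (# 0)) + ℓ (base y (# 1))          ≡⟨ sym neighbour-row-0 ⟩
    row (# 0) y                                  ≡⟨ sym (+-identityʳ _) ⟩
    row (# 0) y + 0                              ≡⟨ sym (neighbourhoodSum-leaf (# 0)) ⟩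
    neighbourhoodSum G (3 + t) ℓ (base x (# 0))  ≡⟨ sums≡ ⟩
    neighbourhoodSum G (3 + t) ℓ (base x (# 1))  ≡⟨ neighbourhoodSum-leaf (# 1) ⟩
    row (# 1) y + 0                              ≡⟨ +-identityʳ _ ⟩
    row (# 1) y                                  ≡⟨ neighbour-row-1 ⟩
    ℓ (base y (# 0)) + ℓ (base y (# 2))          ∎)
    where open ≡-Reasoning

lemma2p3 : (t : ℕ) → 3 ≤ t → (G : Graph) → Connected G → MinDegreeOne G →
    ¬ MycielskianDistanceMagic G t
lemma2p3 (suc (suc (suc t))) (s≤s (s≤s (s≤s z≤n))) G _ (_ , x , deg≡1) (f , _ , magic)
  with degree-one⇒unique-neighbour G x deg≡1
... | y , leaf with Bijection.injective f (toℕ-injective (suc-injective labels≡))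
  where
  label : MVert G (3 + t) → ℕ
  label w = suc (toℕ (Bijection.to f w))

  labels≡ : label (base y (# 1)) ≡ label (base y (# 2))
  labels≡ = equal-neighbourhoodSums⇒equal-labels G t label leaf
              (trans (magic (base x (# 0))) (sym (magic (base x (# 1)))))
... | ()
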